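{- Let $G=(V,E)$ be a connected graph and let $U\subseteq V$ be such that $G[U]$ is connected. Let $T$ and $T'$ be elimination trees of $G$ such that $T'$ is obtained from $T$ by applying $\mathbf{swap}(u,v)$, where $u,v\in V$. (1) If $\{u,v\}\subseteq U$, then either $T'|_U=T|_U$, or $T'|_U$ is obtained from $T|_U$ by applying $\mathbf{swap}(u,v)$. (2) Otherwise, $T'|_U=T|_U$.
   Context: An elimination tree of a connected graph $G$ is a rooted tree on $V$: a root $v$ which has, as children, the roots of elimination trees of each connected component of $G-v$. For an elimination tree $T$, $\mathbf{anc}_T(v)$ denotes the set of proper ancestors of $v$. A swap: given a non-root vertex $u$ of $T$ with parent $v$, $\mathbf{swap}(u,v)$ produces $T'$ where $u$ becomes the parent of $v$ and takes $v$'s former place; subtrees rooted at other children of $v$ stay below $v$; a subtree $S$ rooted at a child of $u$ stays below $u$ unless $S$ lies in the same connected component as $v$ of $K-u$, where $K$ is the subgraph induced by the subtree of $T$ rooted at $u$, in which case $S$ becomes a subtree rooted at $v$. For $U\subseteq V$ with $G[U]$ connected, the projection $T|_U$ is the unique elimination tree of $G[U]$ preserving the ordering of $T$: for $a,b\in U$, $a\in\mathbf{anc}_{T|_U}(b)$ iff $a\in\mathbf{anc}_T(b)$ and $a,b$ are connected in $G[U]-\mathbf{anc}_T(a)$. -}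

module Defs where

open import Level using (0ℓ) renaming (suc to lsuc)
open import Data.Nat using (ℕ)
open import Data.Fin using (Fin)
open import Data.Maybe using (Maybe; just; nothing)
open import Data.Product using (Σ; _×_; _,_; ∃)
open import Data.Sum using (_⊎_)
open import Data.Unit using (⊤)
open import Data.Empty using (⊥)
open import Relation.Nullary using (¬_)
open import Relation.Binary.PropositionalEquality using (_≡_; _≢_)

record Graph (n : ℕ) : Set₁ where
  field
    Adj   : Fin n → Fin n → Set
    sym   : ∀ {x y} → Adj x y → Adj y x
    irrefl : ∀ {x} → ¬ Adj x x
open Graph public

VSet : ℕ → Set₁
VSet n = Fin n → Set

module _ {n : ℕ} (G : Graph n) where

  data Conn (W : VSet n) : Fin n → Fin n → Set where
    here : ∀ {x} → W x → Conn W x x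
    step : ∀ {x y z} → W x → Adj G x y → Conn W y z → Conn W x z

  IsConnected : VSet n → Set
  IsConnected W = (∃ λ x → W x) × (∀ x y → W x → W y → Conn W x y)

  IsComponent : VSet n → VSet n → Set
  IsComponent W C =
    (∃ λ x → C x) ×
    (∀ x → C x → W x) ×
    (∀ x y → C x → C y → Conn W x y) ×
    (∀ x y → C x → Conn W x y → C y)

  _∖[_] : VSet n → Fin n → VSet n
  (W ∖[ r ]) x = W x × x ≢ r

-- Rooted trees (on subsets of Fin n) are represented by parent functions;
-- only the values on the vertex set of the tree are meaningful.
Parent : ℕ → Set
Parent n = Fin n → Maybe (Fin n)

data Anc {n : ℕ} (p : Parent n) : Fin n → Fin n → Set where
  parent : ∀ {a b} → p b ≡ just a → Anc p a b
  up     : ∀ {a b c} → p b ≡ just c → Anc p a c → Anc p a b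

-- IsET G S p q : p (restricted to S) is an elimination tree of G[S], in which
-- the root's parent value is q (q = nothing for a stand-alone tree; q = just r
-- when it hangs below r).
data IsET {n : ℕ} (G : Graph n) (S : VSet n) (p : Parent n) (q : Maybe (Fin n)) : Set₁ where
  node : (r : Fin n) → S r → p r ≡ q →
         ((C : VSet n) → IsComponent G (_∖[_] G S r) C →
            IsET G C p (just r)) →
         IsET G S p q

ElimTree : {n : ℕ} → Graph n → VSet n → Parent n → Set₁
ElimTree G S p = IsET G S p nothing

Subtree : {n : ℕ} → VSet n → Parent n → Fin n → VSet n
Subtree S p w x = S x × (x ≡ w ⊎ Anc p w x)

-- K = G[subtree of v]; a child subtree T_w of u moves below v iff it lies in the
-- connected component of K - u containing v.
SameCompAsV : {n : ℕ} → Graph n → VSet n → Parent n → Fin n → Fin n → Fin n → Set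
SameCompAsV G S p u v w =
  ∀ x → Subtree S p w x → Conn G (_∖[_] G (Subtree S p v) u) x v

record IsSwap {n : ℕ} (G : Graph n) (S : VSet n) (p : Parent n) (u v : Fin n) (p' : Parent n) : Set where
  field
    u∈S        : S u
    v∈S        : S v
    u-child-v  : p u ≡ just v
    u-takes-v  : p' u ≡ p v
    v-below-u  : p' v ≡ just u
    moved      : ∀ w → S w → p w ≡ just u →
                   SameCompAsV G S p u v w → p' w ≡ just v
    stays      : ∀ w → S w → p w ≡ just u →
                   ¬ SameCompAsV G S p u v w → p' w ≡ just u
    unchanged  : ∀ w → S w → w ≢ u → w ≢ v → p w ≢ just u → p' w ≡ p w

IsProjection : {n : ℕ} → Graph n → Parent n → VSet n → Parent n → Set₁
IsProjection G T U P =
  ElimTree G U P ×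
  (∀ a b → U a → U b →
     (Anc P a b → Anc T a b × Conn G (λ x → U x × ¬ Anc T x a) a b) ×
     (Anc T a b × Conn G (λ x → U x × ¬ Anc T x a) a b → Anc P a b))

SameTreeOn : {n : ℕ} → VSet n → Parent n → Parent n → Set
SameTreeOn U P P' = ∀ w → U w → P' w ≡ P w

All : {n : ℕ} → VSet n
All _ = ⊤

{-# OPTIONS --safe #-}
-- Swapping u with its parent v only changes ancestry from u or v, and anc_T′(u) = anc_T(v).
-- Since a ∈ anc_{T|U}(b) iff a ∈ anc_T(b) and a, b are joined in G[U] − anc_T(a), the ancestry
-- from every other vertex is the same in T|U and T′|U.  If u and v are not joined in
-- G[U] − anc_T(v) (in particular if one of them lies outside U), the ancestry from u and v is
-- unchanged as well, so T′|U = T|U.  Otherwise v is the parent of u in T|U, and splitting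
-- the component of G[U] − anc_T(v) at u shows that T′|U is swap(u,v) applied to T|U.
module Submission where

open import Defs hiding (sym)
open import Data.Nat using (ℕ)
open import Data.Fin using (Fin; _≟_)
open import Data.Maybe using (Maybe; just; nothing)
open import Data.Maybe.Properties using (just-injective; ≡-dec)
open import Data.Product using (∃; _×_; _,_; proj₁; proj₂)
open import Data.Sum using (_⊎_; inj₁; inj₂; [_,_]; map₂)
open import Data.Unit using (tt)
open import Data.Empty using (⊥; ⊥-elim)
open import Function using (_∘_; id)
open import Relation.Nullary using (¬_; yes; no)
open import Relation.Unary using (_⊆_)
open import Relation.Binary.PropositionalEquality using (_≡_; _≢_; refl; sym; trans; subst)

module _ {n : ℕ} {p : Parent n} where

  Anc-trans : ∀ {a b c} → Anc p a b → Anc p b c → Anc p a c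
  Anc-trans h (parent e) = up e h
  Anc-trans h (up e h′) = up e (Anc-trans h h′)

  Anc-via-parent : ∀ {a b c} → p b ≡ just c → Anc p a b → a ≡ c ⊎ Anc p a c
  Anc-via-parent e (parent e′) = inj₁ (just-injective (trans (sym e′) e))
  Anc-via-parent e (up e′ h) = inj₂ (subst (Anc p _) (just-injective (trans (sym e′) e)) h)

  ¬Anc-root : ∀ {a b} → p b ≡ nothing → ¬ Anc p a b
  ¬Anc-root e (parent e′) with trans (sym e) e′
  ... | ()
  ¬Anc-root e (up e′ _) with trans (sym e) e′
  ... | ()

  ¬Anc⇒root : ∀ {b} → (∀ {a} → ¬ Anc p a b) → p b ≡ nothing
  ¬Anc⇒root {b} none with p b in e
  ... | nothing = refl
  ... | just _ = ⊥-elim (none (parent e))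

  Anc-linear : ∀ {a b c} → Anc p a c → Anc p b c → a ≡ b ⊎ Anc p a b ⊎ Anc p b a
  Anc-linear (parent e) h₂ with Anc-via-parent e h₂
  ... | inj₁ eq = inj₁ (sym eq)
  ... | inj₂ h = inj₂ (inj₂ h)
  Anc-linear (up e h₁) h₂ with Anc-via-parent e h₂
  ... | inj₁ refl = inj₂ (inj₁ h₁)
  ... | inj₂ h = Anc-linear h₁ h

  nearest-Anc⇒parent : ∀ {a w} → ¬ Anc p a a → Anc p a w →
                       (∀ {c} → Anc p c w → c ≡ a ⊎ Anc p c a) → p w ≡ just a
  nearest-Anc⇒parent _ (parent e) _ = e
  nearest-Anc⇒parent acyclic (up e h) nearest with nearest (parent e)
  ... | inj₁ refl = e
  ... | inj₂ h′ = ⊥-elim (acyclic (Anc-trans h h′))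

  Subtree-Anc : ∀ {S : VSet n} {a b x} → Anc p a b → Subtree S p b x → Subtree S p a x
  Subtree-Anc h (sx , inj₁ refl) = sx , inj₂ h
  Subtree-Anc h (sx , inj₂ h′) = sx , inj₂ (Anc-trans h h′)

EdgesPreservedExcept : {n : ℕ} → Parent n → Parent n → Fin n → Set
EdgesPreservedExcept t t′ p = ∀ {b c} → t b ≡ just c → b ≡ p ⊎ Anc t′ c b

module _ {n : ℕ} {t t′ : Parent n} {p q : Fin n} (edges : EdgesPreservedExcept t t′ p)
         (e : t p ≡ just q) (e′ : t′ q ≡ just p) where

  Anc-preserved-off : ∀ {x a} → x ≢ p → x ≢ q → Anc t x a → Anc t′ x a
  Anc-preserved-off x≢p x≢q (parent eb) with edges eb
  ... | inj₁ refl = ⊥-elim (x≢q (just-injective (trans (sym eb) e)))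
  ... | inj₂ h = h
  Anc-preserved-off x≢p x≢q (up eb h) with edges eb
  ... | inj₂ h′ = Anc-trans (Anc-preserved-off x≢p x≢q h) h′
  ... | inj₁ refl with just-injective (trans (sym eb) e)
  ...   | refl with Anc-via-parent e′ (Anc-preserved-off x≢p x≢q h)
  ...     | inj₁ x≡p = ⊥-elim (x≢p x≡p)
  ...     | inj₂ h′ = h′

_∖Anc[_]_ : {n : ℕ} → VSet n → Parent n → Fin n → VSet n
(U ∖Anc[ t ] a) x = U x × ¬ Anc t x a

∖Anc-mono : {n : ℕ} {U : VSet n} {t t′ : Parent n} {a b : Fin n} →
            (∀ {x} → Anc t′ x b → Anc t x a) → U ∖Anc[ t ] a ⊆ U ∖Anc[ t′ ] b
∖Anc-mono f (ux , ¬h) = ux , ¬h ∘ f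

module _ {n : ℕ} (G : Graph n) where

  infixl 5 _-_
  _-_ : VSet n → Fin n → VSet n
  X - r = _∖[_] G X r

  ∖Anc-parent : ∀ {U : VSet n} {t : Parent n} {a b} → t b ≡ just a →
                (U ∖Anc[ t ] a) - a ⊆ U ∖Anc[ t ] b
  ∖Anc-parent e ((ux , ¬h) , x≢a) = ux , [ x≢a , ¬h ] ∘ Anc-via-parent e

  conn-start : ∀ {W a b} → Conn G W a b → W a
  conn-start (here w) = w
  conn-start (step w _ _) = w

  conn-end : ∀ {W a b} → Conn G W a b → W b
  conn-end (here w) = w
  conn-end (step _ _ r) = conn-end r

  conn-trans : ∀ {W a b c} → Conn G W a b → Conn G W b c → Conn G W a c
  conn-trans (here _) r = r
  conn-trans (step w e r) r′ = step w e (conn-trans r r′)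

  conn-snoc : ∀ {W a b c} → Conn G W a b → W c → Adj G b c → Conn G W a c
  conn-snoc r wc e = conn-trans r (step (conn-end r) e (here wc))

  conn-sym : ∀ {W a b} → Conn G W a b → Conn G W b a
  conn-sym (here w) = here w
  conn-sym (step w e r) = conn-snoc (conn-sym r) w (Graph.sym G e)

  conn-mono : ∀ {X Y a b} → X ⊆ Y → Conn G X a b → Conn G Y a b
  conn-mono X⊆Y (here w) = here (X⊆Y w)
  conn-mono X⊆Y (step w e r) = step (X⊆Y w) e (conn-mono X⊆Y r)

  conn-restrict : ∀ {X Y : VSet n} {a b} → Conn G X a b →
                  (∀ {y} → Conn G X a y → Y y) → Conn G Y a b
  conn-restrict (here w) f = here (f (here w))
  conn-restrict (step w e r) f = step (f (here w)) e (conn-restrict r (f ∘ step w e))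

  conn-split : ∀ {X z₁ z₂ y} → z₁ ≢ z₂ → Conn G X z₁ y →
               Conn G (X - z₂) z₁ y ⊎ Conn G (X - z₁) z₂ y
  conn-split {X} {z₁} {z₂} z₁≢z₂ r = go r (inj₁ (here (conn-start r , z₁≢z₂)))
    where
    Reach : Fin n → Set
    Reach x = Conn G (X - z₂) z₁ x ⊎ Conn G (X - z₁) z₂ x

    -- Restart the path at every visit to z₁ or z₂.
    extend : ∀ {x y} → X y → Adj G x y → Reach x → Reach y
    extend {y = y} xy e s with y ≟ z₂ | y ≟ z₁
    ... | yes refl | _ = inj₂ (here (xy , z₁≢z₂ ∘ sym))
    ... | no _ | yes refl = inj₁ (here (xy , z₁≢z₂))
    ... | no y≢z₂ | no y≢z₁ with s
    ...   | inj₁ r = inj₁ (conn-snoc r (xy , y≢z₂) e)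
    ...   | inj₂ r = inj₂ (conn-snoc r (xy , y≢z₁) e)

    go : ∀ {x y} → Conn G X x y → Reach x → Reach y
    go (here _) s = s
    go (step _ e r) s = go r (extend (conn-start r) e s)

  component : VSet n → Fin n → VSet n
  component W x = Conn G W x

  component-isComponent : ∀ {W x} → W x → IsComponent G W (component W x)
  component-isComponent {x = x} wx =
    (x , here wx) , (λ _ → conn-end) ,
    (λ _ _ cy cz → conn-trans (conn-sym cy) cz) , (λ _ _ → conn-trans)

  private
    Above : Parent n → Maybe (Fin n) → Fin n → Set
    Above p nothing a = ⊥
    Above p (just r) a = a ≡ r ⊎ Anc p a r

    Anc⇒Above : ∀ {p : Parent n} {q r a} → p r ≡ q → Anc p a r → Above p q a
    Anc⇒Above {q = nothing} e h = ¬Anc-root e h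
    Anc⇒Above {q = just _} e h = Anc-via-parent e h

  -- Induction on the tree, carrying the fact that every vertex above it lies outside it.
  IsET-acyclic : ∀ {S p q} → IsET G S p q → (∀ {a} → Above p q a → ¬ S a) →
                 ∀ {x} → S x → ¬ Anc p x x
  IsET-acyclic (node r sr pr sub) outside {x} sx h with x ≟ r
  ... | yes refl = outside (Anc⇒Above pr h) sr
  ... | no x≢r = IsET-acyclic (sub _ (component-isComponent (sx , x≢r))) outside′
                   (here (sx , x≢r)) h
    where
    outside′ : ∀ {a} → Above _ (just r) a → ¬ component (_ - r) x a
    outside′ (inj₁ refl) c = proj₂ (conn-end c) refl
    outside′ (inj₂ h′) c = outside (Anc⇒Above pr h′) (proj₁ (conn-end c))

  ET-acyclic : ∀ {S p} → ElimTree G S p → ∀ {x} → S x → ¬ Anc p x x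
  ET-acyclic et = IsET-acyclic et λ ()

  IsET-parent : ∀ {S p q} → IsET G S p q → ∀ {x} → S x →
                p x ≡ q ⊎ ∃ λ y → p x ≡ just y × S y
  IsET-parent (node r sr pr sub) {x} sx with x ≟ r
  ... | yes refl = inj₁ pr
  ... | no x≢r with IsET-parent (sub _ (component-isComponent (sx , x≢r))) (here (sx , x≢r))
  ...   | inj₁ e = inj₂ (r , e , sr)
  ...   | inj₂ (y , e , cy) = inj₂ (y , e , proj₁ (conn-end cy))

  ET-parent∈ : ∀ {S p a b} → ElimTree G S p → p b ≡ just a → S b → S a
  ET-parent∈ et e sb with IsET-parent et sb
  ... | inj₁ e′ with trans (sym e) e′
  ...   | ()
  ET-parent∈ et e sb | inj₂ (y , e′ , sy) = subst _ (just-injective (trans (sym e′) e)) sy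

  ET-Anc-closed : ∀ {S p} → ElimTree G S p → ∀ {a b} → Anc p a b → S b → S a
  ET-Anc-closed et (parent e) sb = ET-parent∈ et e sb
  ET-Anc-closed et (up e h) sb = ET-Anc-closed et h (ET-parent∈ et e sb)

  IsET-root-Anc : ∀ {S p r₀} → IsET G S p (just r₀) → ∀ {x} → S x → Anc p r₀ x
  IsET-root-Anc (node r sr pr sub) {x} sx with x ≟ r
  ... | yes refl = parent pr
  ... | no x≢r = Anc-trans (parent pr)
                   (IsET-root-Anc (sub _ (component-isComponent (sx , x≢r))) (here (sx , x≢r)))

  IsET-adjacent-comparable : ∀ {S p q} → IsET G S p q → ∀ {x y} → S x → S y →
                             Adj G x y → Anc p x y ⊎ Anc p y x
  IsET-adjacent-comparable (node r sr pr sub) {x} {y} sx sy e with x ≟ r | y ≟ r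
  ... | yes refl | yes refl = ⊥-elim (Graph.irrefl G e)
  ... | yes refl | no y≢r =
    inj₁ (IsET-root-Anc (sub _ (component-isComponent (sy , y≢r))) (here (sy , y≢r)))
  ... | no x≢r | yes refl =
    inj₂ (IsET-root-Anc (sub _ (component-isComponent (sx , x≢r))) (here (sx , x≢r)))
  ... | no x≢r | no y≢r =
    IsET-adjacent-comparable (sub _ (component-isComponent (sx , x≢r))) (here (sx , x≢r))
      (step (sx , x≢r) e (here (sy , y≢r))) e

  -- An edge can only leave the subtree of a upwards, through an ancestor of a.
  path-avoiding-Anc⇒descendant : ∀ {U : VSet n} {t : Parent n} → ElimTree G All t →
                                 ∀ {a b} → Conn G (U ∖Anc[ t ] a) a b → b ≡ a ⊎ Anc t a b
  path-avoiding-Anc⇒descendant {U} {t} et {a} r = go r (inj₁ refl)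
    where
    edge : ∀ {x y} → (U ∖Anc[ t ] a) y → Adj G x y → x ≡ a ⊎ Anc t a x → y ≡ a ⊎ Anc t a y
    edge {x} {y} (_ , ¬y≤a) e sx with IsET-adjacent-comparable et tt tt e | sx
    ... | inj₁ x<y | inj₁ refl = inj₂ x<y
    ... | inj₁ x<y | inj₂ a<x = inj₂ (Anc-trans a<x x<y)
    ... | inj₂ y<x | inj₁ refl = ⊥-elim (¬y≤a y<x)
    ... | inj₂ y<x | inj₂ a<x with Anc-linear a<x y<x
    ...   | inj₁ a≡y = inj₁ (sym a≡y)
    ...   | inj₂ (inj₁ a<y) = inj₂ a<y
    ...   | inj₂ (inj₂ y<a) = ⊥-elim (¬y≤a y<a)

    go : ∀ {x b} → Conn G (U ∖Anc[ t ] a) x b → x ≡ a ⊎ Anc t a x → b ≡ a ⊎ Anc t a b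
    go (here _) s = s
    go (step _ e r) s = go r (edge (conn-start r) e s)

  module Projection {t : Parent n} (et : ElimTree G All t) {U : VSet n} {p : Parent n}
                    (prj : IsProjection G t U p) where

    Anc⇒∈ : ∀ {a b} → Anc p a b → U b → U a
    Anc⇒∈ = ET-Anc-closed (proj₁ prj)

    Anc⇒treeAnc : ∀ {a b} → U b → Anc p a b → Anc t a b
    Anc⇒treeAnc {a} {b} ub h = proj₁ (proj₁ (proj₂ prj a b (Anc⇒∈ h ub) ub) h)

    Anc⇒path : ∀ {a b} → U b → Anc p a b → Conn G (U ∖Anc[ t ] a) a b
    Anc⇒path {a} {b} ub h = proj₂ (proj₁ (proj₂ prj a b (Anc⇒∈ h ub) ub) h)

    path⇒Anc : ∀ {a b} → a ≢ b → Conn G (U ∖Anc[ t ] a) a b → Anc p a b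
    path⇒Anc {a} {b} a≢b r with path-avoiding-Anc⇒descendant et r
    ... | inj₁ b≡a = ⊥-elim (a≢b (sym b≡a))
    ... | inj₂ h = proj₂ (proj₂ prj a b (proj₁ (conn-start r)) (proj₁ (conn-end r))) (h , r)

    acyclic : ∀ {x} → U x → ¬ Anc p x x
    acyclic ux h = ET-acyclic et tt (Anc⇒treeAnc ux h)

    Anc⇒≢ : ∀ {a b} → U b → Anc p a b → a ≢ b
    Anc⇒≢ ub h refl = acyclic ub h

    path⇒Subtree : ∀ {a b} → Conn G (U ∖Anc[ t ] a) a b → Subtree U p a b
    path⇒Subtree {a} {b} r with b ≟ a
    ... | yes b≡a = proj₁ (conn-end r) , inj₁ b≡a
    ... | no b≢a = proj₁ (conn-end r) , inj₂ (path⇒Anc (b≢a ∘ sym) r)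

    Subtree⇒path : ∀ {a b} → Subtree U p a b → Conn G (U ∖Anc[ t ] a) a b
    Subtree⇒path (ub , inj₁ refl) = here (ub , ET-acyclic et tt)
    Subtree⇒path (ub , inj₂ h) = Anc⇒path ub h

    parent-via-tree : ∀ {a b} → U b → t b ≡ just a → Anc p a b → p b ≡ just a
    parent-via-tree {a} {b} ub e h = nearest-Anc⇒parent (acyclic (Anc⇒∈ h ub)) h nearest
      where
      nearest : ∀ {c} → Anc p c b → c ≡ a ⊎ Anc p c a
      nearest hc with Anc-linear hc h
      ... | inj₁ c≡a = inj₁ c≡a
      ... | inj₂ (inj₁ c<a) = inj₂ c<a
      ... | inj₂ (inj₂ a<c) with Anc-via-parent e (Anc⇒treeAnc ub hc)
      ...   | inj₁ c≡a = inj₁ c≡a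
      ...   | inj₂ c<a = ⊥-elim (ET-acyclic et tt
                                   (Anc-trans c<a (Anc⇒treeAnc (Anc⇒∈ hc ub) a<c)))

  -- T₂ arises from T₁ by exchanging p with its parent q: apart from that edge, every edge of
  -- either tree is an ancestry in the other.
  module Exchange {U : VSet n} {T₁ T₂ : Parent n}
                  (et₁ : ElimTree G All T₁) (et₂ : ElimTree G All T₂)
                  {P₁ P₂ : Parent n} (prj₁ : IsProjection G T₁ U P₁) (prj₂ : IsProjection G T₂ U P₂)
                  {p q : Fin n} (e₁ : T₁ p ≡ just q) (e₂ : T₂ q ≡ just p)
                  (edges₁₂ : EdgesPreservedExcept T₁ T₂ p) (edges₂₁ : EdgesPreservedExcept T₂ T₁ q)
                  where

    private
      module Before = Projection et₁ prj₁
      module After = Projection et₂ prj₂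

      acyclic₁ : ∀ {x} → ¬ Anc T₁ x x
      acyclic₁ = ET-acyclic et₁ tt

      acyclic₂ : ∀ {x} → ¬ Anc T₂ x x
      acyclic₂ = ET-acyclic et₂ tt

    p≢q : p ≢ q
    p≢q refl = acyclic₁ (parent e₁)

    Anc-off : ∀ {x a} → x ≢ p → x ≢ q → Anc T₁ x a → Anc T₂ x a
    Anc-off = Anc-preserved-off edges₁₂ e₁ e₂

    Anc-off⁻ : ∀ {x a} → x ≢ p → x ≢ q → Anc T₂ x a → Anc T₁ x a
    Anc-off⁻ x≢p x≢q = Anc-preserved-off edges₂₁ e₂ e₁ x≢q x≢p

    Anc-of-q⇒Anc-of-p : ∀ {x} → Anc T₁ x q → Anc T₂ x p
    Anc-of-q⇒Anc-of-p {x} h with x ≟ p | x ≟ q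
    ... | yes refl | _ = ⊥-elim (acyclic₁ (Anc-trans h (parent e₁)))
    ... | no _ | yes refl = ⊥-elim (acyclic₁ h)
    ... | no x≢p | no x≢q = [ ⊥-elim ∘ x≢p , id ] (Anc-via-parent e₂ (Anc-off x≢p x≢q h))

    Anc-of-p⇒Anc-of-q : ∀ {x} → Anc T₂ x p → Anc T₁ x q
    Anc-of-p⇒Anc-of-q {x} h with x ≟ q | x ≟ p
    ... | yes refl | _ = ⊥-elim (acyclic₂ (Anc-trans h (parent e₂)))
    ... | no _ | yes refl = ⊥-elim (acyclic₂ h)
    ... | no x≢q | no x≢p = [ ⊥-elim ∘ x≢q , id ] (Anc-via-parent e₁ (Anc-off⁻ x≢p x≢q h))

    Anc-of-q-after : ∀ {x} → Anc T₂ x q → x ≡ p ⊎ Anc T₁ x q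
    Anc-of-q-after {x} h with x ≟ p | x ≟ q
    ... | yes x≡p | _ = inj₁ x≡p
    ... | no _ | yes refl = ⊥-elim (acyclic₂ h)
    ... | no x≢p | no x≢q = inj₂ (Anc-off⁻ x≢p x≢q h)

    ∖Anc₁q⊆∖Anc₂p : U ∖Anc[ T₁ ] q ⊆ U ∖Anc[ T₂ ] p
    ∖Anc₁q⊆∖Anc₂p = ∖Anc-mono {U = U} Anc-of-p⇒Anc-of-q

    ∖Anc₂p⊆∖Anc₁q : U ∖Anc[ T₂ ] p ⊆ U ∖Anc[ T₁ ] q
    ∖Anc₂p⊆∖Anc₁q = ∖Anc-mono {U = U} Anc-of-q⇒Anc-of-p

    ∖Anc₁p⊆∖Anc₂p : U ∖Anc[ T₁ ] p ⊆ U ∖Anc[ T₂ ] p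
    ∖Anc₁p⊆∖Anc₂p = ∖Anc-mono {U = U} (up e₁ ∘ Anc-of-p⇒Anc-of-q)

    ∖Anc₁q-p⊆∖Anc₂q : (U ∖Anc[ T₁ ] q) - p ⊆ U ∖Anc[ T₂ ] q
    ∖Anc₁q-p⊆∖Anc₂q ((ux , ¬h) , x≢p) = ux , [ x≢p , ¬h ] ∘ Anc-of-q-after

    -- Such a path stays in the T₁-subtree of a, and ancestry from a ∉ {p, q} survives in T₂.
    path-off : ∀ {a b} → a ≢ p → a ≢ q →
               Conn G (U ∖Anc[ T₁ ] a) a b → Conn G (U ∖Anc[ T₂ ] a) a b
    path-off {a} a≢p a≢q r =
      conn-restrict r λ r′ → proj₁ (conn-end r′) , ¬Anc (path-avoiding-Anc⇒descendant et₁ r′)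
      where
      ¬Anc : ∀ {x} → x ≡ a ⊎ Anc T₁ a x → ¬ Anc T₂ x a
      ¬Anc (inj₁ refl) = acyclic₂
      ¬Anc (inj₂ a<x) x<a = acyclic₂ (Anc-trans (Anc-off a≢p a≢q a<x) x<a)

    projAnc-off : ∀ {a b} → a ≢ p → a ≢ q → U b → Anc P₁ a b → Anc P₂ a b
    projAnc-off a≢p a≢q ub h =
      After.path⇒Anc (Before.Anc⇒≢ ub h) (path-off a≢p a≢q (Before.Anc⇒path ub h))

    projAnc-p : ∀ {b} → U b → Anc P₁ p b → Anc P₂ p b
    projAnc-p ub h =
      After.path⇒Anc (Before.Anc⇒≢ ub h) (conn-mono ∖Anc₁p⊆∖Anc₂p (Before.Anc⇒path ub h))

    projAnc-q : ¬ Conn G (U ∖Anc[ T₁ ] q) q p → ∀ {b} → U b → Anc P₁ q b → Anc P₂ q b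
    projAnc-q no-path ub h = After.path⇒Anc (Before.Anc⇒≢ ub h)
      (conn-mono ∖Anc₁q-p⊆∖Anc₂q (conn-restrict (Before.Anc⇒path ub h)
        λ r → conn-end r , λ y≡p → no-path (subst (Conn G _ q) y≡p r)))

    projAnc-preserved : ¬ Conn G (U ∖Anc[ T₁ ] q) q p →
                        ∀ {a b} → U b → Anc P₁ a b → Anc P₂ a b
    projAnc-preserved no-path {a} ub h with a ≟ p | a ≟ q
    ... | yes refl | _ = projAnc-p ub h
    ... | no _ | yes refl = projAnc-q no-path ub h
    ... | no a≢p | no a≢q = projAnc-off a≢p a≢q ub h

  module Swap {T T′ : Parent n} {u v : Fin n} (sw : IsSwap G All T u v T′) where
    open IsSwap sw

    private
      data Role (b : Fin n) : Set where
        is-u : b ≡ u → Role b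
        is-v : b ≡ v → Role b
        child-of-u : T b ≡ just u → Role b
        untouched : T′ b ≡ T b → Role b

      role : ∀ b → Role b
      role b with b ≟ u | b ≟ v | ≡-dec _≟_ (T b) (just u)
      ... | yes b≡u | _ | _ = is-u b≡u
      ... | no _ | yes b≡v | _ = is-v b≡v
      ... | no _ | no _ | yes e = child-of-u e
      ... | no b≢u | no b≢v | no ne = untouched (unchanged b tt b≢u b≢v ne)

      moved-or-stays : ∀ {b} → T b ≡ just u → T′ b ≡ just u ⊎ T′ b ≡ just v
      moved-or-stays {b} e with ≡-dec _≟_ (T′ b) (just v)
      ... | yes e′ = inj₂ e′
      ... | no ne = inj₁ (stays b tt e (ne ∘ moved b tt e))

    edges-preserved : EdgesPreservedExcept T T′ u
    edges-preserved {b} e with role b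
    ... | is-u b≡u = inj₁ b≡u
    ... | is-v refl = inj₂ (up v-below-u (parent (trans u-takes-v e)))
    ... | untouched e′ = inj₂ (parent (trans e′ e))
    ... | child-of-u e′ with just-injective (trans (sym e) e′) | moved-or-stays e′
    ...   | refl | inj₁ e″ = inj₂ (parent e″)
    ...   | refl | inj₂ e″ = inj₂ (up e″ (parent v-below-u))

    edges-reflected : EdgesPreservedExcept T′ T v
    edges-reflected {b} e with role b
    ... | is-u refl = inj₂ (up u-child-v (parent (trans (sym u-takes-v) e)))
    ... | is-v b≡v = inj₁ b≡v
    ... | untouched e′ = inj₂ (parent (trans (sym e′) e))
    ... | child-of-u e′ with moved-or-stays e′
    ...   | inj₁ e″ = inj₂ (subst (λ c → Anc T c b) (just-injective (trans (sym e″) e)) (parent e′))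
    ...   | inj₂ e″ = inj₂ (subst (λ c → Anc T c b) (just-injective (trans (sym e″) e))
                                  (up e′ (parent u-child-v)))

  module SwapProjection {U : VSet n} {T T′ : Parent n}
                        (eT : ElimTree G All T) (eT′ : ElimTree G All T′)
                        {u v : Fin n} (sw : IsSwap G All T u v T′)
                        {P P′ : Parent n} (prj : IsProjection G T U P) (prj′ : IsProjection G T′ U P′)
                        where

    open IsSwap sw using () renaming (u-child-v to Tu≡v; v-below-u to T′v≡u)
    open Swap sw

    private
      module Fwd = Exchange eT eT′ prj prj′ Tu≡v T′v≡u edges-preserved edges-reflected
      module Bwd = Exchange eT′ eT prj′ prj T′v≡u Tu≡v edges-reflected edges-preserved
      module Before = Projection eT prj
      module After = Projection eT′ prj′

    u≢v : u ≢ v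
    u≢v = Fwd.p≢q

    projAnc-off⁺ : ∀ {a b} → a ≢ u → a ≢ v → U b → Anc P a b → Anc P′ a b
    projAnc-off⁺ = Fwd.projAnc-off

    projAnc-off⁻ : ∀ {a b} → a ≢ u → a ≢ v → U b → Anc P′ a b → Anc P a b
    projAnc-off⁻ a≢u a≢v = Bwd.projAnc-off a≢v a≢u

    same-parents : (∀ {a b} → U b → Anc P a b → Anc P′ a b) →
                   (∀ {a b} → U b → Anc P′ a b → Anc P a b) → SameTreeOn U P P′
    same-parents to from w uw with P w in e
    ... | nothing = ¬Anc⇒root (¬Anc-root e ∘ from uw)
    ... | just a = nearest-Anc⇒parent (After.acyclic ua) (to uw (parent e))
                     (map₂ (to ua) ∘ Anc-via-parent e ∘ from uw)
      where
      ua : U a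
      ua = Before.Anc⇒∈ (parent e) uw

    same-projection : ¬ Conn G (U ∖Anc[ T ] v) v u → SameTreeOn U P P′
    same-projection no-path =
      same-parents (Fwd.projAnc-preserved no-path) (Bwd.projAnc-preserved no-path′)
      where
      no-path′ : ¬ Conn G (U ∖Anc[ T′ ] u) u v
      no-path′ = no-path ∘ conn-sym ∘ conn-mono Fwd.∖Anc₂p⊆∖Anc₁q

    ¬parent⇒no-path : U u → P u ≢ just v → ¬ Conn G (U ∖Anc[ T ] v) v u
    ¬parent⇒no-path uu Pu≢v = Pu≢v ∘ Before.parent-via-tree uu Tu≡v ∘ Before.path⇒Anc (u≢v ∘ sym)

    module SwapCase (uu : U u) (uv : U v) (pu : P u ≡ just v) where

      u-above-v : Anc P′ u v
      u-above-v = After.path⇒Anc u≢v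
        (conn-mono Fwd.∖Anc₁q⊆∖Anc₂p (conn-sym (Before.Anc⇒path uu (parent pu))))

      -- The subtree of v in P and that of u in P′ are both the component of
      -- U ∖ anc_T(v) = U ∖ anc_T′(u) containing u and v.
      below-u′⇒below-v : ∀ {w} → U w → w ≢ v → Anc P′ u w → Anc P v w
      below-u′⇒below-v uw w≢v h = Before.path⇒Anc (w≢v ∘ sym)
        (conn-trans (Before.Anc⇒path uu (parent pu)) (conn-mono Fwd.∖Anc₂p⊆∖Anc₁q (After.Anc⇒path uw h)))

      below-v⇒below-u′ : ∀ {w} → U w → w ≢ u → Anc P v w → Anc P′ u w
      below-v⇒below-u′ uw w≢u h = After.path⇒Anc (w≢u ∘ sym)
        (conn-mono Fwd.∖Anc₁q⊆∖Anc₂p (conn-trans (conn-sym (Before.Anc⇒path uu (parent pu)))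
                                                  (Before.Anc⇒path uw h)))

      below-v-split : ∀ {w} → U w → w ≢ u → Anc P v w → Anc P′ v w ⊎ Anc P u w
      below-v-split uw w≢u h with conn-split (u≢v ∘ sym) (Before.Anc⇒path uw h)
      ... | inj₁ r = inj₁ (After.path⇒Anc (Before.Anc⇒≢ uw h) (conn-mono Fwd.∖Anc₁q-p⊆∖Anc₂q r))
      ... | inj₂ r = inj₂ (Before.path⇒Anc (w≢u ∘ sym) (conn-mono (∖Anc-parent {U = U} Tu≡v) r))

      above-v-preserved : ∀ {c b} → Anc P c v → U b → Anc P c b → Anc P′ c b
      above-v-preserved c<v = projAnc-off⁺
        (λ c≡u → Before.acyclic uu (Anc-trans (subst (λ z → Anc P z v) c≡u c<v) (parent pu)))
        (Before.Anc⇒≢ uv c<v)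

      above-u′⇒above-v : ∀ {c} → Anc P′ c u → Anc P c v
      above-u′⇒above-v {c} h with c ≟ u | c ≟ v
      ... | yes refl | _ = ⊥-elim (After.acyclic uu h)
      ... | no _ | yes refl = ⊥-elim (After.acyclic uu (Anc-trans u-above-v h))
      ... | no c≢u | no c≢v =
        [ ⊥-elim ∘ c≢v , id ] (Anc-via-parent pu (projAnc-off⁻ c≢u c≢v uu h))

      P′u≡Pv : P′ u ≡ P v
      P′u≡Pv with P v in e
      ... | nothing = ¬Anc⇒root (¬Anc-root e ∘ above-u′⇒above-v)
      ... | just a = nearest-Anc⇒parent (After.acyclic ua)
        (above-v-preserved (parent e) uu (Anc-trans (parent e) (parent pu)))
        λ h → map₂ (above-v-preserved (above-u′⇒above-v h) ua) (Anc-via-parent e (above-u′⇒above-v h))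
        where
        ua : U a
        ua = Before.Anc⇒∈ (parent e) uv

      P′v≡u : P′ v ≡ just u
      P′v≡u = nearest-Anc⇒parent (After.acyclic uu) u-above-v nearest
        where
        nearest : ∀ {c} → Anc P′ c v → c ≡ u ⊎ Anc P′ c u
        nearest {c} h with c ≟ u | c ≟ v
        ... | yes c≡u | _ = inj₁ c≡u
        ... | no _ | yes refl = ⊥-elim (After.acyclic uv h)
        ... | no c≢u | no c≢v =
          inj₂ (projAnc-off⁺ c≢u c≢v uu (Anc-trans (projAnc-off⁻ c≢u c≢v uv h) (parent pu)))

      module ChildOfU {w : Fin n} (uw : U w) (pw : P w ≡ just u) where

        w≢u : w ≢ u
        w≢u = Before.Anc⇒≢ uw (parent pw) ∘ sym

        v-above-w : Anc P v w
        v-above-w = Anc-trans (parent pu) (parent pw)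

        w≢v : w ≢ v
        w≢v = Before.Anc⇒≢ uw v-above-w ∘ sym

        above-w-off : ∀ {c} → c ≢ u → c ≢ v → Anc P′ c w → Anc P′ c u
        above-w-off c≢u c≢v h =
          projAnc-off⁺ c≢u c≢v uu
            ([ ⊥-elim ∘ c≢u , id ] (Anc-via-parent pw (projAnc-off⁻ c≢u c≢v uw h)))

        below-v′ : Anc P′ v w → P′ w ≡ just v
        below-v′ h = nearest-Anc⇒parent (After.acyclic uv) h nearest
          where
          nearest : ∀ {c} → Anc P′ c w → c ≡ v ⊎ Anc P′ c v
          nearest {c} hc with c ≟ v | c ≟ u
          ... | yes c≡v | _ = inj₁ c≡v
          ... | no _ | yes refl = inj₂ u-above-v
          ... | no c≢v | no c≢u = inj₂ (Anc-trans (above-w-off c≢u c≢v hc) u-above-v)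

        not-below-v′ : ¬ Anc P′ v w → P′ w ≡ just u
        not-below-v′ ¬h =
          nearest-Anc⇒parent (After.acyclic uu) (below-v⇒below-u′ uw w≢u v-above-w) nearest
          where
          nearest : ∀ {c} → Anc P′ c w → c ≡ u ⊎ Anc P′ c u
          nearest {c} hc with c ≟ u | c ≟ v
          ... | yes c≡u | _ = inj₁ c≡u
          ... | no _ | yes refl = ⊥-elim (¬h hc)
          ... | no c≢u | no c≢v = inj₂ (above-w-off c≢u c≢v hc)

        Subtree-v-u⊆∖Anc′v : (Subtree U P v) - u ⊆ U ∖Anc[ T′ ] v
        Subtree-v-u⊆∖Anc′v ((ux , sx) , x≢u) =
          ux , [ x≢u , proj₂ (conn-end (Before.Subtree⇒path (ux , sx))) ] ∘ Fwd.Anc-of-q-after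

        sameComp⇒below-v′ : SameCompAsV G U P u v w → Anc P′ v w
        sameComp⇒below-v′ s =
          After.path⇒Anc (w≢v ∘ sym) (conn-sym (conn-mono Subtree-v-u⊆∖Anc′v (s w (uw , inj₁ refl))))

        below-v′⇒sameComp : Anc P′ v w → SameCompAsV G U P u v w
        below-v′⇒sameComp h x sx =
          conn-trans (conn-sym (conn-restrict (Before.Subtree⇒path sx) in-w))
                     (conn-sym (conn-restrict (After.Anc⇒path uw h) in-v))
          where
          in-v : ∀ {y} → Conn G (U ∖Anc[ T′ ] v) v y → ((Subtree U P v) - u) y
          in-v r = Before.path⇒Subtree (conn-mono Bwd.∖Anc₁p⊆∖Anc₂p r) ,
                   λ y≡u → proj₂ (conn-end r) (subst (λ z → Anc T′ z v) (sym y≡u) (parent T′v≡u))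

          in-w : ∀ {y} → Conn G (U ∖Anc[ T ] w) w y → ((Subtree U P v) - u) y
          in-w {y} r = Subtree-Anc {S = U} v-above-w sy ,
                       λ y≡u → ¬u∈Subtree-w (subst (Subtree U P w) y≡u sy)
            where
            sy : Subtree U P w y
            sy = Before.path⇒Subtree r

            ¬u∈Subtree-w : ¬ Subtree U P w u
            ¬u∈Subtree-w (_ , inj₁ u≡w) = w≢u (sym u≡w)
            ¬u∈Subtree-w (_ , inj₂ w<u) = Before.acyclic uw (Anc-trans w<u (parent pw))

      moved : ∀ w → U w → P w ≡ just u → SameCompAsV G U P u v w → P′ w ≡ just v
      moved w uw pw = below-v′ ∘ sameComp⇒below-v′
        where open ChildOfU uw pw

      stays : ∀ w → U w → P w ≡ just u → ¬ SameCompAsV G U P u v w → P′ w ≡ just u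
      stays w uw pw ¬s = not-below-v′ (¬s ∘ below-v′⇒sameComp)
        where open ChildOfU uw pw

      root-unchanged : ∀ {w} → U w → w ≢ v → P w ≡ nothing → P′ w ≡ nothing
      root-unchanged {w} uw w≢v e = ¬Anc⇒root ¬Anc
        where
        ¬Anc : ∀ {c} → ¬ Anc P′ c w
        ¬Anc {c} h with c ≟ u | c ≟ v
        ... | yes refl | _ = ¬Anc-root e (below-u′⇒below-v uw w≢v h)
        ... | no _ | yes refl = ¬Anc-root e (Bwd.projAnc-p uw h)
        ... | no c≢u | no c≢v = ¬Anc-root e (projAnc-off⁻ c≢u c≢v uw h)

      below-v-unchanged : ∀ {w} → U w → w ≢ u → P w ≡ just v → P′ w ≡ just v
      below-v-unchanged {w} uw w≢u e = nearest-Anc⇒parent (After.acyclic uv) v-above-w nearest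
        where
        v-above-w : Anc P′ v w
        v-above-w with below-v-split uw w≢u (parent e)
        ... | inj₁ h = h
        ... | inj₂ u<w with Anc-via-parent e u<w
        ...   | inj₁ u≡v = ⊥-elim (u≢v u≡v)
        ...   | inj₂ u<v = ⊥-elim (Before.acyclic uu (Anc-trans u<v (parent pu)))

        nearest : ∀ {c} → Anc P′ c w → c ≡ v ⊎ Anc P′ c v
        nearest {c} h with c ≟ v | c ≟ u
        ... | yes c≡v | _ = inj₁ c≡v
        ... | no _ | yes refl = inj₂ u-above-v
        ... | no c≢v | no c≢u with Anc-via-parent e (projAnc-off⁻ c≢u c≢v uw h)
        ...   | inj₁ c≡v = ⊥-elim (c≢v c≡v)
        ...   | inj₂ c<v = inj₂ (above-v-preserved c<v uv c<v)

      other-parent-unchanged : ∀ {w a} → U w → w ≢ v → P w ≡ just a → a ≢ u → a ≢ v →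
                               P′ w ≡ just a
      other-parent-unchanged {w} {a} uw w≢v e a≢u a≢v =
        nearest-Anc⇒parent (After.acyclic ua) a-above-w nearest
        where
        ua : U a
        ua = Before.Anc⇒∈ (parent e) uw

        a-above-w : Anc P′ a w
        a-above-w = projAnc-off⁺ a≢u a≢v uw (parent e)

        v-above-a : Anc P v w → Anc P v a
        v-above-a = [ ⊥-elim ∘ a≢v ∘ sym , id ] ∘ Anc-via-parent e

        nearest : ∀ {c} → Anc P′ c w → c ≡ a ⊎ Anc P′ c a
        nearest {c} h with c ≟ u | c ≟ v
        ... | yes refl | _ =
          inj₂ (below-v⇒below-u′ ua a≢u (v-above-a (below-u′⇒below-v uw w≢v h)))
        ... | no _ | yes refl with Anc-linear h a-above-w
        ...   | inj₁ v≡a = ⊥-elim (a≢v (sym v≡a))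
        ...   | inj₂ (inj₁ v<a) = inj₂ v<a
        ...   | inj₂ (inj₂ a<v) =
          ⊥-elim (Before.acyclic ua
                    (Anc-trans (projAnc-off⁻ a≢u a≢v uv a<v) (v-above-a (Bwd.projAnc-p uw h))))
        nearest {c} h | no c≢u | no c≢v =
          map₂ (projAnc-off⁺ c≢u c≢v ua) (Anc-via-parent e (projAnc-off⁻ c≢u c≢v uw h))

      unchanged : ∀ w → U w → w ≢ u → w ≢ v → P w ≢ just u → P′ w ≡ P w
      unchanged w uw w≢u w≢v Pw≢u with P w in e
      ... | nothing = root-unchanged uw w≢v e
      ... | just a with a ≟ u | a ≟ v
      ...   | yes refl | _ = ⊥-elim (Pw≢u refl)
      ...   | no _ | yes refl = below-v-unchanged uw w≢u e
      ...   | no a≢u | no a≢v = other-parent-unchanged uw w≢v e a≢u a≢v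

      projection-swap : IsSwap G U P u v P′
      projection-swap = record
        { u∈S = uu ; v∈S = uv ; u-child-v = pu ; u-takes-v = P′u≡Pv ; v-below-u = P′v≡u
        ; moved = moved ; stays = stays ; unchanged = unchanged }

lemma1 : {n : ℕ} (G : Graph n) → IsConnected G All →
    (U : VSet n) → IsConnected G U →
    (T T' : Parent n) → ElimTree G All T → ElimTree G All T' →
    (u v : Fin n) → IsSwap G All T u v T' →
    (P P' : Parent n) → IsProjection G T U P → IsProjection G T' U P' →
    ((U u × U v) → SameTreeOn U P P' ⊎ IsSwap G U P u v P') ×
    (¬ (U u × U v) → SameTreeOn U P P')
lemma1 G _ U _ T T' eT eT' u v sw P P' prj prj' = inside , outside
  where
  open SwapProjection G eT eT' sw prj prj'

  inside : U u × U v → SameTreeOn U P P' ⊎ IsSwap G U P u v P'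
  inside (uu , uv) with ≡-dec _≟_ (P u) (just v)
  ... | yes pu = inj₂ (SwapCase.projection-swap uu uv pu)
  ... | no Pu≢v = inj₁ (same-projection (¬parent⇒no-path uu Pu≢v))

  outside : ¬ (U u × U v) → SameTreeOn U P P'
  outside ¬both = same-projection λ r → ¬both (proj₁ (conn-end G r) , proj₁ (conn-start G r))
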